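{- Let $\mathbf{A}$ be a Bochvar algebra. Let $\mathbb{B}_{\mathbf{A}}=\langle\mathbf{A}_{i_0},\mathbf{K}\rangle$ be its associated Bochvar system, and let $\mathbf{A}_{\mathbb{B}_{\mathbf{A}}}$ be the Bochvar algebra associated with this Bochvar system. Then $\mathbf{A}_{\mathbb{B}_{\mathbf{A}}}$ is isomorphic to $\mathbf{A}$.
   Context: Bochvar algebras: $\mathbf{WK}^e$ is the algebra on $\{0,\tfrac12,1\}$ of type $\langle\wedge,\vee,\neg,J_2,0,1\rangle$ with $\neg0=1,\neg\tfrac12=\tfrac12,\neg1=0$, $\vee,\wedge$ Boolean on $\{0,1\}$ and outputting $\tfrac12$ whenever an argument is $\tfrac12$, $J_21=1$, $J_2\tfrac12=J_20=0$; Bochvar algebras form $ISP(\mathbf{WK}^e)$. The $\langle\wedge,\vee,\neg,0,1\rangle$-reduct of a Bochvar algebra is an involutive bisemilattice, hence a Płonka sum $\mathrm{P}_{\!\!\!\text{\l}}(\mathbf{A}_i)_{i\in I}$ of Boolean algebras over a semilattice direct system with lower-bounded join-semilattice $\langle I,\vee,i_0\rangle$. A Bochvar system is a pair $\langle\mathbf{B},\mathbf{I}\rangle$, $\mathbf{B}$ a Boolean algebra and $I\subseteq B$ containing $1$ and closed under $\wedge$. Associated Bochvar system of a Bochvar algebra $\mathbf{A}$: $\mathbb{B}_{\mathbf{A}}=\langle\mathbf{A}_{i_0},\mathbf{K}\rangle$ with $K=\{J_2(1^{\mathbf{A}_i}): i\in I\}$ ($1^{\mathbf{A}_i}$ the top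 of fibre $\mathbf{A}_i$). Associated Bochvar algebra of a Bochvar system $\langle\mathbf{B},\mathbf{I}\rangle$: the unique Bochvar algebra $\mathbf{A}_{\mathbb{B}}$ whose involutive bisemilattice reduct is the Płonka sum of the system with fibres $\mathbf{B}/[i)$ ($i\in I$, $[i)$ the principal filter generated by $i$), index semilattice $I$ ordered by $i\le j$ iff $j\le_{\mathbf{B}} i$ (join $i\wedge j$, least element $1$), and maps $p_{ij}(a/[i))=a/[j)$. -}

module Defs where

open import Data.Product using (Σ; Σ-syntax; _×_; _,_; proj₁; proj₂)
open import Data.Unit using (⊤; tt)
open import Data.Empty using (⊥)
open import Relation.Binary.PropositionalEquality
  using (_≡_; refl; sym; trans; cong; cong₂)

data W : Set where
  w0 w½ w1 : W

¬W : W → W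
¬W w0 = w1
¬W w½ = w½
¬W w1 = w0

infixr 7 _∧W_
infixr 6 _∨W_

_∧W_ : W → W → W
w0 ∧W w0 = w0
w0 ∧W w½ = w½
w0 ∧W w1 = w0
w½ ∧W w0 = w½
w½ ∧W w½ = w½
w½ ∧W w1 = w½
w1 ∧W w0 = w0
w1 ∧W w½ = w½
w1 ∧W w1 = w1

_∨W_ : W → W → W
w0 ∨W w0 = w0
w0 ∨W w½ = w½
w0 ∨W w1 = w1
w½ ∨W w0 = w½
w½ ∨W w½ = w½
w½ ∨W w1 = w½
w1 ∨W w0 = w1
w1 ∨W w½ = w½
w1 ∨W w1 = w1

J₂W : W → W
J₂W w0 = w0
J₂W w½ = w0
J₂W w1 = w1

record Alg : Set₁ where
  infixr 7 _∧_
  infixr 6 _∨_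
  field
    Carrier : Set
    _∧_ _∨_ : Carrier → Carrier → Carrier
    ¬_ J₂   : Carrier → Carrier
    𝟎 𝟏     : Carrier

-- Bochvar algebras: the class ISP(WK^e), i.e. algebras admitting an
-- injective homomorphism into a power (WK^e)^X.
record IsBochvar (A : Alg) : Set₁ where
  open Alg A
  field
    Idx   : Set
    h     : Carrier → Idx → W
    h-inj : ∀ a b → (∀ x → h a x ≡ h b x) → a ≡ b
    h-∧   : ∀ a b x → h (a ∧ b) x ≡ h a x ∧W h b x
    h-∨   : ∀ a b x → h (a ∨ b) x ≡ h a x ∨W h b x
    h-¬   : ∀ a x → h (¬ a) x ≡ ¬W (h a x)
    h-J₂  : ∀ a x → h (J₂ a) x ≡ J₂W (h a x)
    h-𝟎   : ∀ x → h 𝟎 x ≡ w0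
    h-𝟏   : ∀ x → h 𝟏 x ≡ w1

-- Algebras of the same type over a carrier with an equality relation
-- (needed because fibres of the associated algebra are quotients B/[i)).

record SAlg : Set₁ where
  infix 4 _≈_
  infixr 7 _∧_
  infixr 6 _∨_
  field
    Carrier : Set
    _≈_     : Carrier → Carrier → Set
    _∧_ _∨_ : Carrier → Carrier → Carrier
    ¬_ J₂   : Carrier → Carrier
    𝟎 𝟏     : Carrier

toSAlg : Alg → SAlg
toSAlg A = record
  { Carrier = Carrier ; _≈_ = _≡_ ; _∧_ = _∧_ ; _∨_ = _∨_
  ; ¬_ = ¬_ ; J₂ = J₂ ; 𝟎 = 𝟎 ; 𝟏 = 𝟏 }
  where open Alg A

record Iso (S T : SAlg) : Set where
  private
    module S = SAlg S
    module T = SAlg T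
  field
    to       : S.Carrier → T.Carrier
    from     : T.Carrier → S.Carrier
    to-cong  : ∀ {a b} → a S.≈ b → to a T.≈ to b
    from-cong : ∀ {a b} → a T.≈ b → from a S.≈ from b
    to-from  : ∀ y → to (from y) T.≈ y
    from-to  : ∀ x → from (to x) S.≈ x
    to-∧     : ∀ a b → to (a S.∧ b) T.≈ (to a T.∧ to b)
    to-∨     : ∀ a b → to (a S.∨ b) T.≈ (to a T.∨ to b)
    to-¬     : ∀ a → to (S.¬ a) T.≈ T.¬ (to a)
    to-J₂    : ∀ a → to (S.J₂ a) T.≈ T.J₂ (to a)
    to-𝟎     : to S.𝟎 T.≈ T.𝟎
    to-𝟏     : to S.𝟏 T.≈ T.𝟏

record BoolOps : Set₁ where
  infix 4 _≈_
  infixr 7 _∧_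
  infixr 6 _∨_
  field
    Carrier : Set
    _≈_     : Carrier → Carrier → Set
    _∧_ _∨_ : Carrier → Carrier → Carrier
    ¬_      : Carrier → Carrier
    ⊥ᴮ ⊤ᴮ   : Carrier

  _≤_ : Carrier → Carrier → Set
  a ≤ b = a ∧ b ≈ a

  _⇔_ : Carrier → Carrier → Carrier
  a ⇔ b = (¬ a ∨ b) ∧ (¬ b ∨ a)

  -- a is congruent to b modulo the principal filter [i) = {c | i ≤ c}
  CongMod : Carrier → Carrier → Carrier → Set
  CongMod i a b = i ≤ (a ⇔ b)

record BochvarSystem : Set₁ where
  field
    B   : BoolOps
  open BoolOps B public
  field
    I   : Carrier → Set
    I-⊤ : I ⊤ᴮ
    I-∧ : ∀ {i j} → I i → I j → I (i ∧ j)

-- The associated Bochvar algebra A_𝔹: Płonka sum of the fibres B/[i)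
-- (i ∈ I) over the semilattice ⟨I, ∧, 1⟩ (i ≤ j iff j ≤_B i), with
-- p_{ij}(a/[i)) = a/[j).  Elements are pairs (i , a) standing for a/[i)
-- in the fibre i.  J₂(a/[i)) = (a ∧ i)/[1).
module _ (𝔹 : BochvarSystem) where
  open BochvarSystem 𝔹

  PCarrier : Set
  PCarrier = Σ[ i ∈ Carrier ] (I i × Carrier)

  assocAlg : SAlg
  assocAlg = record
    { Carrier = PCarrier
    ; _≈_ = λ { (i , _ , a) (j , _ , b) → (i ≈ j) × (CongMod i a b) }
    ; _∧_ = λ { (i , p , a) (j , q , b) → (i ∧ j , I-∧ p q , a ∧ b) }
    ; _∨_ = λ { (i , p , a) (j , q , b) → (i ∧ j , I-∧ p q , a ∨ b) }
    ; ¬_  = λ { (i , p , a) → (i , p , ¬ a) }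
    ; J₂  = λ { (i , p , a) → (⊤ᴮ , I-⊤ , a ∧ i) }
    ; 𝟎   = (⊤ᴮ , I-⊤ , ⊥ᴮ)
    ; 𝟏   = (⊤ᴮ , I-⊤ , ⊤ᴮ)
    }

private
  Bool01 : W → Set
  Bool01 w½ = ⊥
  Bool01 _  = ⊤

  TopW : W → Set
  TopW w0 = ⊥
  TopW _  = ⊤

  in0-W : ∀ w → w1 ∨W (w1 ∧W w) ≡ w1 → Bool01 w
  in0-W w0 _ = tt
  in0-W w½ ()
  in0-W w1 _ = tt

  in0-W' : ∀ w → Bool01 w → w1 ∨W (w1 ∧W w) ≡ w1
  in0-W' w0 _ = refl
  in0-W' w1 _ = refl

  absW : ∀ w → w ∨W (w ∧W w1) ≡ w
  absW w0 = refl
  absW w½ = refl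
  absW w1 = refl

  ∧1W : ∀ w → w ∧W w1 ≡ w
  ∧1W w0 = refl
  ∧1W w½ = refl
  ∧1W w1 = refl

  B∧ : ∀ u v → Bool01 u → Bool01 v → Bool01 (u ∧W v)
  B∧ w0 w0 _ _ = tt
  B∧ w0 w1 _ _ = tt
  B∧ w1 w0 _ _ = tt
  B∧ w1 w1 _ _ = tt

  B∨ : ∀ u v → Bool01 u → Bool01 v → Bool01 (u ∨W v)
  B∨ w0 w0 _ _ = tt
  B∨ w0 w1 _ _ = tt
  B∨ w1 w0 _ _ = tt
  B∨ w1 w1 _ _ = tt

  B¬ : ∀ u → Bool01 u → Bool01 (¬W u)
  B¬ w0 _ = tt
  B¬ w1 _ = tt

  fib¬₁ : ∀ w → w ∨W (w ∧W ¬W w) ≡ w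
  fib¬₁ w0 = refl
  fib¬₁ w½ = refl
  fib¬₁ w1 = refl

  fib¬₂ : ∀ w → ¬W w ∨W (¬W w ∧W w) ≡ ¬W w
  fib¬₂ w0 = refl
  fib¬₂ w½ = refl
  fib¬₂ w1 = refl

  topW : ∀ w → ¬W w ∧W w ≡ ¬W w → TopW w
  topW w0 ()
  topW w½ _ = tt
  topW w1 _ = tt

  fibW : ∀ u v → v ∨W (v ∧W u) ≡ v → u ≡ w½ → v ≡ w½
  fibW w½ w0 () refl
  fibW w½ w½ _ refl = refl
  fibW w½ w1 () refl

  topComb : ∀ b t₁ t₂ → TopW t₁ → TopW t₂ → (t₁ ∧W t₂ ≡ w½ → b ≡ w½)
          → b ∧W (t₁ ∧W t₂) ≡ b
  topComb w½ _  _  _ _ _ = lem _ _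
    where lem : ∀ x y → w½ ∧W (x ∧W y) ≡ w½
          lem w0 w0 = refl
          lem w0 w½ = refl
          lem w0 w1 = refl
          lem w½ w0 = refl
          lem w½ w½ = refl
          lem w½ w1 = refl
          lem w1 w0 = refl
          lem w1 w½ = refl
          lem w1 w1 = refl
  topComb w0 w½ w½ _ _ f with f refl
  ... | ()
  topComb w0 w½ w1 _ _ f with f refl
  ... | ()
  topComb w0 w1 w½ _ _ f with f refl
  ... | ()
  topComb w0 w1 w1 _ _ _ = refl
  topComb w1 w½ w½ _ _ f with f refl
  ... | ()
  topComb w1 w½ w1 _ _ f with f refl
  ... | ()
  topComb w1 w1 w½ _ _ f with f refl
  ... | ()
  topComb w1 w1 w1 _ _ _ = refl

  J∧W : ∀ u v → J₂W (u ∧W v) ≡ J₂W u ∧W J₂W v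
  J∧W w0 w0 = refl
  J∧W w0 w½ = refl
  J∧W w0 w1 = refl
  J∧W w½ w0 = refl
  J∧W w½ w½ = refl
  J∧W w½ w1 = refl
  J∧W w1 w0 = refl
  J∧W w1 w½ = refl
  J∧W w1 w1 = refl

module _ (A : Alg) (E : IsBochvar A) where
  open Alg A
  open IsBochvar E

  SameFibre : Carrier → Carrier → Set
  SameFibre a b = (a ∨ (a ∧ b) ≡ a) × (b ∨ (b ∧ a) ≡ b)

  InFibre₀ : Carrier → Set
  InFibre₀ a = SameFibre a 𝟏

  IsFibreTop : Carrier → Set
  IsFibreTop t = ∀ b → SameFibre t b → b ∧ t ≡ b

  private
    pt : ∀ {a b} → a ≡ b → ∀ x → h a x ≡ h b x
    pt e x = cong (λ z → h z x) e

    in0⇒ : ∀ {a} → InFibre₀ a → ∀ x → Bool01 (h a x)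
    in0⇒ {a} (_ , e) x = in0-W (h a x)
      (trans (sym (trans (h-∨ 𝟏 (𝟏 ∧ a) x)
                   (cong₂ _∨W_ (h-𝟏 x) (trans (h-∧ 𝟏 a x)
                                         (cong (_∧W h a x) (h-𝟏 x))))))
             (trans (pt e x) (h-𝟏 x)))

    ⇒in0 : ∀ {a} → (∀ x → Bool01 (h a x)) → InFibre₀ a
    ⇒in0 {a} f =
        h-inj _ _ (λ x → trans (h-∨ a (a ∧ 𝟏) x)
          (trans (cong (h a x ∨W_) (trans (h-∧ a 𝟏 x) (cong (h a x ∧W_) (h-𝟏 x))))
                 (absW (h a x))))
      , h-inj _ _ (λ x → trans (h-∨ 𝟏 (𝟏 ∧ a) x)
          (trans (cong₂ _∨W_ (h-𝟏 x) (trans (h-∧ 𝟏 a x) (cong (_∧W h a x) (h-𝟏 x))))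
                 (trans (in0-W' (h a x) (f x)) (sym (h-𝟏 x)))))

  Fibre₀ : Set
  Fibre₀ = Σ Carrier InFibre₀

  fibre₀ : BoolOps
  fibre₀ = record
    { Carrier = Fibre₀
    ; _≈_ = λ a b → proj₁ a ≡ proj₁ b
    ; _∧_ = λ { (a , p) (b , q) → a ∧ b , ⇒in0 (λ x →
          subst01 (h-∧ a b x) (B∧ _ _ (in0⇒ p x) (in0⇒ q x))) }
    ; _∨_ = λ { (a , p) (b , q) → a ∨ b , ⇒in0 (λ x →
          subst01 (h-∨ a b x) (B∨ _ _ (in0⇒ p x) (in0⇒ q x))) }
    ; ¬_ = λ { (a , p) → ¬ a , ⇒in0 (λ x →
          subst01 (h-¬ a x) (B¬ _ (in0⇒ p x))) }
    ; ⊥ᴮ = 𝟎 , ⇒in0 (λ x → subst01 (h-𝟎 x) tt)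
    ; ⊤ᴮ = 𝟏 , ⇒in0 (λ x → subst01 (h-𝟏 x) tt)
    }
    where
      subst01 : ∀ {u v} → u ≡ v → Bool01 v → Bool01 u
      subst01 refl b = b

  K : Fibre₀ → Set
  K k = Σ[ t ∈ Carrier ] (IsFibreTop t × (J₂ t ≡ proj₁ k))

  private
    K-⊤ : K (BoolOps.⊤ᴮ fibre₀)
    K-⊤ = 𝟏
        , (λ b _ → h-inj _ _ (λ x → trans (h-∧ b 𝟏 x)
                    (trans (cong (h b x ∧W_) (h-𝟏 x)) (∧1W (h b x)))))
        , h-inj _ _ (λ x → trans (h-J₂ 𝟏 x) (trans (cong J₂W (h-𝟏 x)) (sym (h-𝟏 x))))

    topPt : ∀ {t} → IsFibreTop t → ∀ x → TopW (h t x)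
    topPt {t} top x = topW (h t x)
      (trans (sym (trans (h-∧ (¬ t) t x) (cong (_∧W h t x) (h-¬ t x))))
             (trans (pt (top (¬ t) fib) x) (h-¬ t x)))
      where
        fib : SameFibre t (¬ t)
        fib = h-inj _ _ (λ y → trans (h-∨ t (t ∧ ¬ t) y)
                 (trans (cong (h t y ∨W_) (trans (h-∧ t (¬ t) y)
                                           (cong (h t y ∧W_) (h-¬ t y))))
                        (fib¬₁ (h t y))))
            , h-inj _ _ (λ y → trans (h-∨ (¬ t) (¬ t ∧ t) y)
                 (trans (cong₂ _∨W_ (h-¬ t y) (trans (h-∧ (¬ t) t y)
                                           (cong (_∧W h t y) (h-¬ t y))))
                        (trans (fib¬₂ (h t y)) (sym (h-¬ t y)))))

    K-∧ : ∀ {k l} → K k → K l → K (BoolOps._∧_ fibre₀ k l)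
    K-∧ {k} {l} (t₁ , top₁ , e₁) (t₂ , top₂ , e₂) =
        t₁ ∧ t₂
      , (λ b fb → h-inj _ _ (λ x →
           trans (h-∧ b (t₁ ∧ t₂) x)
           (trans (cong (h b x ∧W_) (h-∧ t₁ t₂ x))
           (topComb (h b x) (h t₁ x) (h t₂ x) (topPt top₁ x) (topPt top₂ x)
             (λ eq → fibW (h (t₁ ∧ t₂) x) (h b x)
                (trans (sym (trans (h-∨ b (b ∧ (t₁ ∧ t₂)) x)
                          (cong (h b x ∨W_) (h-∧ b (t₁ ∧ t₂) x))))
                       (pt (proj₂ fb) x))
                (trans (h-∧ t₁ t₂ x) eq))))))
      , trans (h-inj _ _ (λ x → trans (h-J₂ (t₁ ∧ t₂) x)
                (trans (cong J₂W (h-∧ t₁ t₂ x))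
                (trans (J∧W (h t₁ x) (h t₂ x))
                (sym (trans (h-∧ (J₂ t₁) (J₂ t₂) x)
                        (cong₂ _∧W_ (h-J₂ t₁ x) (h-J₂ t₂ x))))))))
              (cong₂ _∧_ e₁ e₂)

  assocSystem : BochvarSystem
  assocSystem = record { B = fibre₀ ; I = K ; I-⊤ = K-⊤ ; I-∧ = λ {k} {l} → K-∧ {k} {l} }

-- Every element y of A lies in the fibre whose top is y ∨ ¬ y, and it is
-- recovered from the Boolean element J₂ y of the least fibre as
-- J₂ y ∧ (y ∨ ¬ y).  Conversely the class a/[J₂ t) in the fibre with top t
-- is sent to a ∧ t.  Since A embeds into a power of WK^e, every identity
-- needed for these two maps to be mutually inverse homomorphisms reduces to
-- a finite check in WK^e, where elements of the least fibre take values in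
-- {0, 1} and fibre tops take values in {½, 1}.
module Submission where

open import Defs
open import Data.Product using (_×_; _,_; proj₁; proj₂)
open import Relation.Binary.PropositionalEquality
  using (_≡_; refl; sym; trans; cong; cong₂)

data IsBool : W → Set where
  0-isBool : IsBool w0
  1-isBool : IsBool w1

data IsTop : W → Set where
  ½-isTop : IsTop w½
  1-isTop : IsTop w1

infixr 5 _⇔W_

_⇔W_ : W → W → W
u ⇔W v = (¬W u ∨W v) ∧W (¬W v ∨W u)

SameFibreW : W → W → Set
SameFibreW u v = (u ∨W (u ∧W v) ≡ u) × (v ∨W (v ∧W u) ≡ v)

∧W-identityʳ : ∀ w → w ∧W w1 ≡ w
∧W-identityʳ w0 = refl
∧W-identityʳ w½ = refl
∧W-identityʳ w1 = refl

isBool-J₂W : ∀ w → IsBool (J₂W w)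
isBool-J₂W w0 = 0-isBool
isBool-J₂W w½ = 0-isBool
isBool-J₂W w1 = 1-isBool

sameFibreW-w1⇒isBool : ∀ w → SameFibreW w w1 → IsBool w
sameFibreW-w1⇒isBool w0 _        = 0-isBool
sameFibreW-w1⇒isBool w½ (_ , ())
sameFibreW-w1⇒isBool w1 _        = 1-isBool

isBool⇒sameFibreW-w1 : ∀ {w} → IsBool w → SameFibreW w w1
isBool⇒sameFibreW-w1 0-isBool = refl , refl
isBool⇒sameFibreW-w1 1-isBool = refl , refl

sameFibreW-¬W : ∀ w → SameFibreW w (¬W w)
sameFibreW-¬W w0 = refl , refl
sameFibreW-¬W w½ = refl , refl
sameFibreW-¬W w1 = refl , refl

¬W-below⇒isTop : ∀ w → ¬W w ∧W w ≡ ¬W w → IsTop w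
¬W-below⇒isTop w0 ()
¬W-below⇒isTop w½ _ = ½-isTop
¬W-below⇒isTop w1 _ = 1-isTop

sameFibreW-∨¬W⇒below : ∀ v u → SameFibreW (v ∨W ¬W v) u → u ∧W (v ∨W ¬W v) ≡ u
sameFibreW-∨¬W⇒below w0 u  _        = ∧W-identityʳ u
sameFibreW-∨¬W⇒below w1 u  _        = ∧W-identityʳ u
sameFibreW-∨¬W⇒below w½ w0 (_ , ())
sameFibreW-∨¬W⇒below w½ w½ _        = refl
sameFibreW-∨¬W⇒below w½ w1 (_ , ())

J₂W-∧W-∨¬W : ∀ w → J₂W w ∧W (w ∨W ¬W w) ≡ w
J₂W-∧W-∨¬W w0 = refl
J₂W-∧W-∨¬W w½ = refl
J₂W-∧W-∨¬W w1 = refl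

⇔W-refl : ∀ {b} → IsBool b → ∀ k → k ∧W (b ⇔W b) ≡ k
⇔W-refl 0-isBool = ∧W-identityʳ
⇔W-refl 1-isBool = ∧W-identityʳ

∧W-top-cong : ∀ {a b t u} → IsBool a → IsBool b → IsTop t → IsTop u →
  J₂W t ≡ J₂W u → J₂W t ∧W (a ⇔W b) ≡ J₂W t → a ∧W t ≡ b ∧W u
∧W-top-cong 0-isBool 0-isBool ½-isTop ½-isTop _ _ = refl
∧W-top-cong 0-isBool 1-isBool ½-isTop ½-isTop _ _ = refl
∧W-top-cong 1-isBool 0-isBool ½-isTop ½-isTop _ _ = refl
∧W-top-cong 1-isBool 1-isBool ½-isTop ½-isTop _ _ = refl
∧W-top-cong _        _        ½-isTop 1-isTop () _
∧W-top-cong _        _        1-isTop ½-isTop () _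
∧W-top-cong 0-isBool 0-isBool 1-isTop 1-isTop _ _ = refl
∧W-top-cong 0-isBool 1-isBool 1-isTop 1-isTop _ ()
∧W-top-cong 1-isBool 0-isBool 1-isTop 1-isTop _ ()
∧W-top-cong 1-isBool 1-isBool 1-isTop 1-isTop _ _ = refl

J₂W-∨¬W-∧W-top : ∀ {a t} → IsBool a → IsTop t →
  J₂W ((a ∧W t) ∨W ¬W (a ∧W t)) ≡ J₂W t
J₂W-∨¬W-∧W-top 0-isBool ½-isTop = refl
J₂W-∨¬W-∧W-top 0-isBool 1-isTop = refl
J₂W-∨¬W-∧W-top 1-isBool ½-isTop = refl
J₂W-∨¬W-∧W-top 1-isBool 1-isTop = refl

J₂W-∧W-top-⇔W : ∀ {a t} → IsBool a → IsTop t →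
  J₂W ((a ∧W t) ∨W ¬W (a ∧W t)) ∧W (J₂W (a ∧W t) ⇔W a)
    ≡ J₂W ((a ∧W t) ∨W ¬W (a ∧W t))
J₂W-∧W-top-⇔W 0-isBool ½-isTop = refl
J₂W-∧W-top-⇔W 0-isBool 1-isTop = refl
J₂W-∧W-top-⇔W 1-isBool ½-isTop = refl
J₂W-∧W-top-⇔W 1-isBool 1-isTop = refl

∧W-top-¬W : ∀ {a t} → IsBool a → IsTop t → ¬W a ∧W t ≡ ¬W (a ∧W t)
∧W-top-¬W 0-isBool ½-isTop = refl
∧W-top-¬W 0-isBool 1-isTop = refl
∧W-top-¬W 1-isBool ½-isTop = refl
∧W-top-¬W 1-isBool 1-isTop = refl

∧W-top-J₂W : ∀ {a t} → IsBool a → IsTop t → (a ∧W J₂W t) ∧W w1 ≡ J₂W (a ∧W t)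
∧W-top-J₂W 0-isBool ½-isTop = refl
∧W-top-J₂W 0-isBool 1-isTop = refl
∧W-top-J₂W 1-isBool ½-isTop = refl
∧W-top-J₂W 1-isBool 1-isTop = refl

∧W-top-∧W : ∀ {a b t u} → IsBool a → IsBool b → IsTop t → IsTop u →
  (a ∧W b) ∧W (t ∧W u) ≡ (a ∧W t) ∧W (b ∧W u)
∧W-top-∧W 0-isBool 0-isBool ½-isTop ½-isTop = refl
∧W-top-∧W 0-isBool 0-isBool ½-isTop 1-isTop = refl
∧W-top-∧W 0-isBool 0-isBool 1-isTop ½-isTop = refl
∧W-top-∧W 0-isBool 0-isBool 1-isTop 1-isTop = refl
∧W-top-∧W 0-isBool 1-isBool ½-isTop ½-isTop = refl
∧W-top-∧W 0-isBool 1-isBool ½-isTop 1-isTop = refl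
∧W-top-∧W 0-isBool 1-isBool 1-isTop ½-isTop = refl
∧W-top-∧W 0-isBool 1-isBool 1-isTop 1-isTop = refl
∧W-top-∧W 1-isBool 0-isBool ½-isTop ½-isTop = refl
∧W-top-∧W 1-isBool 0-isBool ½-isTop 1-isTop = refl
∧W-top-∧W 1-isBool 0-isBool 1-isTop ½-isTop = refl
∧W-top-∧W 1-isBool 0-isBool 1-isTop 1-isTop = refl
∧W-top-∧W 1-isBool 1-isBool ½-isTop ½-isTop = refl
∧W-top-∧W 1-isBool 1-isBool ½-isTop 1-isTop = refl
∧W-top-∧W 1-isBool 1-isBool 1-isTop ½-isTop = refl
∧W-top-∧W 1-isBool 1-isBool 1-isTop 1-isTop = refl

∧W-top-∨W : ∀ {a b t u} → IsBool a → IsBool b → IsTop t → IsTop u →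
  (a ∨W b) ∧W (t ∧W u) ≡ (a ∧W t) ∨W (b ∧W u)
∧W-top-∨W 0-isBool 0-isBool ½-isTop ½-isTop = refl
∧W-top-∨W 0-isBool 0-isBool ½-isTop 1-isTop = refl
∧W-top-∨W 0-isBool 0-isBool 1-isTop ½-isTop = refl
∧W-top-∨W 0-isBool 0-isBool 1-isTop 1-isTop = refl
∧W-top-∨W 0-isBool 1-isBool ½-isTop ½-isTop = refl
∧W-top-∨W 0-isBool 1-isBool ½-isTop 1-isTop = refl
∧W-top-∨W 0-isBool 1-isBool 1-isTop ½-isTop = refl
∧W-top-∨W 0-isBool 1-isBool 1-isTop 1-isTop = refl
∧W-top-∨W 1-isBool 0-isBool ½-isTop ½-isTop = refl
∧W-top-∨W 1-isBool 0-isBool ½-isTop 1-isTop = refl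
∧W-top-∨W 1-isBool 0-isBool 1-isTop ½-isTop = refl
∧W-top-∨W 1-isBool 0-isBool 1-isTop 1-isTop = refl
∧W-top-∨W 1-isBool 1-isBool ½-isTop ½-isTop = refl
∧W-top-∨W 1-isBool 1-isBool ½-isTop 1-isTop = refl
∧W-top-∨W 1-isBool 1-isBool 1-isTop ½-isTop = refl
∧W-top-∨W 1-isBool 1-isBool 1-isTop 1-isTop = refl

-- Terms with constants from A: h sends the value of a term in A to its
-- value in WK^e, so identities between terms can be checked pointwise.
module Pointwise (A : Alg) (E : IsBochvar A) where
  open Alg A
  open IsBochvar E

  infixr 7 _∧ₜ_
  infixr 6 _∨ₜ_
  infix 9 ‵_
  infix 8 ¬ₜ_ J₂ₜ_

  data Term : Set where
    ‵_        : Carrier → Term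
    _∧ₜ_ _∨ₜ_ : Term → Term → Term
    ¬ₜ_ J₂ₜ_  : Term → Term
    𝟎ₜ 𝟏ₜ     : Term

  ⟦_⟧ : Term → Carrier
  ⟦ ‵ a ⟧    = a
  ⟦ e ∧ₜ f ⟧ = ⟦ e ⟧ ∧ ⟦ f ⟧
  ⟦ e ∨ₜ f ⟧ = ⟦ e ⟧ ∨ ⟦ f ⟧
  ⟦ ¬ₜ e ⟧   = ¬ ⟦ e ⟧
  ⟦ J₂ₜ e ⟧ = J₂ ⟦ e ⟧
  ⟦ 𝟎ₜ ⟧     = 𝟎
  ⟦ 𝟏ₜ ⟧     = 𝟏

  ⟦_⟧ʷ : Term → Idx → W
  ⟦ ‵ a ⟧ʷ    i = h a i
  ⟦ e ∧ₜ f ⟧ʷ i = ⟦ e ⟧ʷ i ∧W ⟦ f ⟧ʷ i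
  ⟦ e ∨ₜ f ⟧ʷ i = ⟦ e ⟧ʷ i ∨W ⟦ f ⟧ʷ i
  ⟦ ¬ₜ e ⟧ʷ   i = ¬W (⟦ e ⟧ʷ i)
  ⟦ J₂ₜ e ⟧ʷ i  = J₂W (⟦ e ⟧ʷ i)
  ⟦ 𝟎ₜ ⟧ʷ     i = w0
  ⟦ 𝟏ₜ ⟧ʷ     i = w1

  h-⟦⟧ : ∀ e i → h ⟦ e ⟧ i ≡ ⟦ e ⟧ʷ i
  h-⟦⟧ (‵ a)    i = refl
  h-⟦⟧ (e ∧ₜ f) i = trans (h-∧ _ _ i) (cong₂ _∧W_ (h-⟦⟧ e i) (h-⟦⟧ f i))
  h-⟦⟧ (e ∨ₜ f) i = trans (h-∨ _ _ i) (cong₂ _∨W_ (h-⟦⟧ e i) (h-⟦⟧ f i))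
  h-⟦⟧ (¬ₜ e)   i = trans (h-¬ _ i) (cong ¬W (h-⟦⟧ e i))
  h-⟦⟧ (J₂ₜ e)  i = trans (h-J₂ _ i) (cong J₂W (h-⟦⟧ e i))
  h-⟦⟧ 𝟎ₜ       i = h-𝟎 i
  h-⟦⟧ 𝟏ₜ       i = h-𝟏 i

  ≡⇒pointwise : ∀ e f → ⟦ e ⟧ ≡ ⟦ f ⟧ → ∀ i → ⟦ e ⟧ʷ i ≡ ⟦ f ⟧ʷ i
  ≡⇒pointwise e f e≡f i =
    trans (sym (h-⟦⟧ e i)) (trans (cong (λ x → h x i) e≡f) (h-⟦⟧ f i))

  pointwise⇒≡ : ∀ e f → (∀ i → ⟦ e ⟧ʷ i ≡ ⟦ f ⟧ʷ i) → ⟦ e ⟧ ≡ ⟦ f ⟧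
  pointwise⇒≡ e f e≗f =
    h-inj _ _ (λ i → trans (h-⟦⟧ e i) (trans (e≗f i) (sym (h-⟦⟧ f i))))

  sameFibre⇒pointwise : ∀ e f → SameFibre A E ⟦ e ⟧ ⟦ f ⟧ →
    ∀ i → SameFibreW (⟦ e ⟧ʷ i) (⟦ f ⟧ʷ i)
  sameFibre⇒pointwise e f (p , q) i =
    ≡⇒pointwise (e ∨ₜ e ∧ₜ f) e p i , ≡⇒pointwise (f ∨ₜ f ∧ₜ e) f q i

  pointwise⇒sameFibre : ∀ e f → (∀ i → SameFibreW (⟦ e ⟧ʷ i) (⟦ f ⟧ʷ i)) →
    SameFibre A E ⟦ e ⟧ ⟦ f ⟧
  pointwise⇒sameFibre e f sf =
      pointwise⇒≡ (e ∨ₜ e ∧ₜ f) e (λ i → proj₁ (sf i))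
    , pointwise⇒≡ (f ∨ₜ f ∧ₜ e) f (λ i → proj₂ (sf i))

module Reconstruction (A : Alg) (E : IsBochvar A) where
  open Alg A
  open IsBochvar E
  open Pointwise A E

  inFibre₀⇒isBool : ∀ {a} → InFibre₀ A E a → ∀ i → IsBool (h a i)
  inFibre₀⇒isBool {a} p i =
    sameFibreW-w1⇒isBool (h a i) (sameFibre⇒pointwise (‵ a) 𝟏ₜ p i)

  J₂-inFibre₀ : ∀ y → InFibre₀ A E (J₂ y)
  J₂-inFibre₀ y =
    pointwise⇒sameFibre (J₂ₜ ‵ y) 𝟏ₜ (λ i → isBool⇒sameFibreW-w1 (isBool-J₂W (h y i)))

  -- ¬ t lies in the fibre of t, so ¬ t ≤ t, which rules out the value 0.
  isFibreTop⇒isTop : ∀ {t} → IsFibreTop A E t → ∀ i → IsTop (h t i)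
  isFibreTop⇒isTop {t} top i =
    ¬W-below⇒isTop (h t i) (≡⇒pointwise (¬ₜ ‵ t ∧ₜ ‵ t) (¬ₜ ‵ t) (top (¬ t) t~¬t) i)
    where
    t~¬t : SameFibre A E t (¬ t)
    t~¬t = pointwise⇒sameFibre (‵ t) (¬ₜ ‵ t) (λ j → sameFibreW-¬W (h t j))

  ∨¬-isFibreTop : ∀ y → IsFibreTop A E (y ∨ ¬ y)
  ∨¬-isFibreTop y b y∨¬y~b = pointwise⇒≡ (‵ b ∧ₜ (‵ y ∨ₜ ¬ₜ ‵ y)) (‵ b) (λ i →
    sameFibreW-∨¬W⇒below (h y i) (h b i)
      (sameFibre⇒pointwise (‵ y ∨ₜ ¬ₜ ‵ y) (‵ b) y∨¬y~b i))

  S : SAlg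
  S = assocAlg (assocSystem A E)

  open SAlg S using (_≈_) renaming
    (Carrier to P; _∧_ to _∧ₚ_; _∨_ to _∨ₚ_; ¬_ to ¬ₚ_; J₂ to J₂ₚ; 𝟎 to 𝟎ₚ; 𝟏 to 𝟏ₚ)

  to : P → Carrier
  to (_ , (t , _) , (a , _)) = a ∧ t

  from : Carrier → P
  from y = (J₂ (y ∨ ¬ y) , J₂-inFibre₀ _) , (y ∨ ¬ y , ∨¬-isFibreTop y , refl)
         , (J₂ y , J₂-inFibre₀ y)

  -- Matching the witness J₂ t ≡ k of k ∈ K on refl turns the index k into J₂ t.
  to-cong : ∀ {x x′} → x ≈ x′ → to x ≡ to x′
  to-cong {_ , (t , top , refl) , (a , a₀)} {_ , (t′ , top′ , refl) , (a′ , a₀′)}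
          (J₂t≡J₂t′ , a≡a′mod) =
    pointwise⇒≡ (‵ a ∧ₜ ‵ t) (‵ a′ ∧ₜ ‵ t′) (λ i →
      ∧W-top-cong (inFibre₀⇒isBool a₀ i) (inFibre₀⇒isBool a₀′ i)
        (isFibreTop⇒isTop top i) (isFibreTop⇒isTop top′ i)
        (≡⇒pointwise (J₂ₜ ‵ t) (J₂ₜ ‵ t′) J₂t≡J₂t′ i)
        (≡⇒pointwise (J₂ₜ ‵ t ∧ₜ (¬ₜ ‵ a ∨ₜ ‵ a′) ∧ₜ (¬ₜ ‵ a′ ∨ₜ ‵ a)) (J₂ₜ ‵ t)
          a≡a′mod i))

  from-cong : ∀ {y y′} → y ≡ y′ → from y ≈ from y′
  from-cong {y} refl = refl , pointwise⇒≡
    (J₂ₜ (‵ y ∨ₜ ¬ₜ ‵ y) ∧ₜ (¬ₜ J₂ₜ ‵ y ∨ₜ J₂ₜ ‵ y) ∧ₜ (¬ₜ J₂ₜ ‵ y ∨ₜ J₂ₜ ‵ y))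
    (J₂ₜ (‵ y ∨ₜ ¬ₜ ‵ y))
    (λ i → ⇔W-refl (isBool-J₂W (h y i)) _)

  to-from : ∀ y → to (from y) ≡ y
  to-from y = pointwise⇒≡ (J₂ₜ ‵ y ∧ₜ (‵ y ∨ₜ ¬ₜ ‵ y)) (‵ y) (λ i → J₂W-∧W-∨¬W (h y i))

  from-to : ∀ x → from (to x) ≈ x
  from-to (_ , (t , top , refl) , (a , a₀)) =
      pointwise⇒≡ (J₂ₜ (y ∨ₜ ¬ₜ y)) (J₂ₜ ‵ t) (λ i →
        J₂W-∨¬W-∧W-top (inFibre₀⇒isBool a₀ i) (isFibreTop⇒isTop top i))
    , pointwise⇒≡ (J₂ₜ (y ∨ₜ ¬ₜ y) ∧ₜ (¬ₜ J₂ₜ y ∨ₜ ‵ a) ∧ₜ (¬ₜ ‵ a ∨ₜ J₂ₜ y))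
        (J₂ₜ (y ∨ₜ ¬ₜ y)) (λ i →
        J₂W-∧W-top-⇔W (inFibre₀⇒isBool a₀ i) (isFibreTop⇒isTop top i))
    where
    y : Term
    y = ‵ a ∧ₜ ‵ t

  to-∧ : ∀ x x′ → to (x ∧ₚ x′) ≡ to x ∧ to x′
  to-∧ (_ , (t , top , _) , (a , a₀)) (_ , (t′ , top′ , _) , (a′ , a₀′)) =
    pointwise⇒≡ ((‵ a ∧ₜ ‵ a′) ∧ₜ (‵ t ∧ₜ ‵ t′)) ((‵ a ∧ₜ ‵ t) ∧ₜ (‵ a′ ∧ₜ ‵ t′)) (λ i →
      ∧W-top-∧W (inFibre₀⇒isBool a₀ i) (inFibre₀⇒isBool a₀′ i)
        (isFibreTop⇒isTop top i) (isFibreTop⇒isTop top′ i))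

  to-∨ : ∀ x x′ → to (x ∨ₚ x′) ≡ to x ∨ to x′
  to-∨ (_ , (t , top , _) , (a , a₀)) (_ , (t′ , top′ , _) , (a′ , a₀′)) =
    pointwise⇒≡ ((‵ a ∨ₜ ‵ a′) ∧ₜ (‵ t ∧ₜ ‵ t′)) (‵ a ∧ₜ ‵ t ∨ₜ ‵ a′ ∧ₜ ‵ t′) (λ i →
      ∧W-top-∨W (inFibre₀⇒isBool a₀ i) (inFibre₀⇒isBool a₀′ i)
        (isFibreTop⇒isTop top i) (isFibreTop⇒isTop top′ i))

  to-¬ : ∀ x → to (¬ₚ x) ≡ ¬ to x
  to-¬ (_ , (t , top , _) , (a , a₀)) =
    pointwise⇒≡ (¬ₜ ‵ a ∧ₜ ‵ t) (¬ₜ (‵ a ∧ₜ ‵ t)) (λ i →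
      ∧W-top-¬W (inFibre₀⇒isBool a₀ i) (isFibreTop⇒isTop top i))

  to-J₂ : ∀ x → to (J₂ₚ x) ≡ J₂ (to x)
  to-J₂ (_ , (t , top , refl) , (a , a₀)) =
    pointwise⇒≡ ((‵ a ∧ₜ J₂ₜ ‵ t) ∧ₜ 𝟏ₜ) (J₂ₜ (‵ a ∧ₜ ‵ t)) (λ i →
      ∧W-top-J₂W (inFibre₀⇒isBool a₀ i) (isFibreTop⇒isTop top i))

  to-𝟎 : to 𝟎ₚ ≡ 𝟎
  to-𝟎 = pointwise⇒≡ (𝟎ₜ ∧ₜ 𝟏ₜ) 𝟎ₜ (λ _ → refl)

  to-𝟏 : to 𝟏ₚ ≡ 𝟏
  to-𝟏 = pointwise⇒≡ (𝟏ₜ ∧ₜ 𝟏ₜ) 𝟏ₜ (λ _ → refl)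

theorem3p5 : (A : Alg) (E : IsBochvar A) →
    Iso (assocAlg (assocSystem A E)) (toSAlg A)
theorem3p5 A E = record
  { to        = to
  ; from      = from
  ; to-cong   = λ {x} {x′} → to-cong {x} {x′}
  ; from-cong = from-cong
  ; to-from   = to-from
  ; from-to   = from-to
  ; to-∧      = to-∧
  ; to-∨      = to-∨
  ; to-¬      = to-¬
  ; to-J₂     = to-J₂
  ; to-𝟎      = to-𝟎
  ; to-𝟏      = to-𝟏
  }
  where open Reconstruction A E
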